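{- Let $x\in{}^\omega(\omega-\{0\})$ be strictly increasing and suppose $T_n$ is an $x$-squeezed tree for each $n\in\omega$. Then there are a tree $T^*$ and an increasing sequence of integers $\langle\gamma_t:t\in\omega\rangle$ such that $T^*$ is $x$-squeezed, $\gamma_0=0$, $t<\gamma_t$ for all $t>0$, and for every $f\in{}^{<\omega}\omega$: $f\in T^*$ if and only if for every $t>0$ there is $s<t$ with $f\restriction\gamma_t\in T_{\gamma_s}$.
   Context: For $f\in{}^{<\omega}\omega$ and $k\in\omega$, $f\restriction k$ denotes the restriction of $f$ to $\min(k,\mathrm{length}(f))$. For strictly increasing $x$ and $n\in\omega$, $(j,k,m)$ is an $x$-bound system above $n$ iff $k\in\omega$, $j,m:\{0,\dots,k\}\to\omega$, $j(0)>x(n+m(0)+1)$ and $j(l+1)>x(j(l)+m(l+1)+1)$ for $l<k$. A tree $T\subseteq{}^{<\omega}\omega$ (closed under initial segments) is $(j,k,m,\eta)$-squeezed iff $\mathrm{dom}(\eta)=\{(l,t):l\le k,\ t\le m(l)\}$, $\eta(l,t)\in{}^{j(l)}\omega$, and every $\nu\in T$ is comparable with some $\eta(l,t)$; $T$ is $x$-squeezed iff for every $n$ there are an $x$-bound system $(j,k,m)$ above $n$ and $\eta$ with $T$ $(j,k,m,\eta)$-squeezed. -}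

module Defs where

open import Data.Nat using (ℕ; zero; suc; _+_; _<_; _≤_)
open import Data.Fin using (Fin; toℕ; inject₁) renaming (suc to fsuc; zero to fzero)
open import Data.List using (List; _++_; length; take)
open import Data.Product using (Σ; _×_; ∃)
open import Data.Sum using (_⊎_)
open import Relation.Binary.PropositionalEquality using (_≡_)

Seq : Set
Seq = List ℕ

-- f ↾ k : restriction to min(k, length f)
_↾_ : Seq → ℕ → Seq
f ↾ k = take k f

_⊑_ : Seq → Seq → Set
a ⊑ b = Σ Seq λ c → a ++ c ≡ b

Comparable : Seq → Seq → Set
Comparable a b = (a ⊑ b) ⊎ (b ⊑ a)

StrictlyIncreasing : (ℕ → ℕ) → Set
StrictlyIncreasing x = ∀ m n → m < n → x m < x n

IsTree : (Seq → Set) → Set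
IsTree T = ∀ f g → f ⊑ g → T g → T f

BoundSystem : (ℕ → ℕ) → ℕ → (k : ℕ) → (Fin (suc k) → ℕ) → (Fin (suc k) → ℕ) → Set
BoundSystem x n k j m =
  (x (n + m fzero + 1) < j fzero) ×
  (∀ (l : Fin k) → x (j (inject₁ l) + m (fsuc l) + 1) < j (fsuc l))

IsSqueezedBy : (Seq → Set) → (k : ℕ) → (j m : Fin (suc k) → ℕ)
             → ((l : Fin (suc k)) → Fin (suc (m l)) → Seq) → Set
IsSqueezedBy T k j m η =
  (∀ l t → length (η l t) ≡ j l) ×
  (∀ ν → T ν → Σ (Fin (suc k)) λ l → Σ (Fin (suc (m l))) λ t → Comparable ν (η l t))

XSqueezed : (ℕ → ℕ) → (Seq → Set) → Set
XSqueezed x T = ∀ n →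
  Σ ℕ λ k → Σ (Fin (suc k) → ℕ) λ j → Σ (Fin (suc k) → ℕ) λ m →
    BoundSystem x n k j m ×
    Σ ((l : Fin (suc k)) → Fin (suc (m l)) → Seq) λ η → IsSqueezedBy T k j m η

module Submission where

-- Present a squeeze of a tree above n as a nonempty list of
-- "blocks": block l has a height j(l), a width m(l) and the m(l)+1 nodes
-- η(l,0), …, η(l,m(l)) of length j(l).  The bound-system condition becomes a
-- chaining condition between consecutive blocks, so two chained lists can be
-- concatenated, the second starting above the last height of the first.  Hence
-- the union of finitely many x-squeezed trees is squeezed above every n, by the
-- concatenation of their squeezes.
--   The sequence γ is defined by recursion: γ 0 = 0 and γ (t+1) exceeds t+1,
-- γ t and every height used by the union-squeeze above t of the trees
-- T (γ 0), …, T (γ t).  T* is defined by the required characterisation.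

open import Defs
open import Data.Nat using (ℕ; zero; suc; _+_; _≤_; _<_; z≤n; s≤s)
open import Data.Nat.Properties
  using (≤-trans; ≤-reflexive; <-trans; m≤m+n; m≤n+m; m≤n⇒m≤1+n; m<1+n⇒m<n∨m≡n)
open import Data.Fin using (Fin) renaming (suc to fsuc; zero to fzero)
open import Data.List using (List; []; _∷_; _++_; length; take; drop; tabulate; lookup; map)
open import Data.List.Properties using (take++drop≡id; ++-assoc)
open import Data.List.Extrema.Nat using (max; xs≤max)
open import Data.List.Membership.Propositional using (_∈_)
open import Data.List.Relation.Unary.All as All using (All; []; _∷_)
import Data.List.Relation.Unary.All.Properties as All
open import Data.List.Relation.Unary.Any as Any using (Any; here; there)
import Data.List.Relation.Unary.Any.Properties as Any
open import Data.Product using (Σ; _×_; _,_)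
open import Data.Sum using (inj₁; inj₂)
open import Data.Unit using (⊤; tt)
open import Function.Bundles using (_⇔_; mk⇔)
open import Function using (id; _∘_)
open import Relation.Binary.PropositionalEquality using (_≡_; refl; sym; trans; cong)

restrict-⊑ : ∀ k f c → (f ↾ k) ⊑ ((f ++ c) ↾ k)
restrict-⊑ zero    f       c = [] , refl
restrict-⊑ (suc k) []      c = take (suc k) c , refl
restrict-⊑ (suc k) (a ∷ f) c = let d , p = restrict-⊑ k f c in d , cong (a ∷_) p

comparable-∷ : ∀ a f e → Comparable f e → Comparable (a ∷ f) (a ∷ e)
comparable-∷ a f e (inj₁ (c , p)) = inj₁ (c , cong (a ∷_) p)
comparable-∷ a f e (inj₂ (c , p)) = inj₂ (c , cong (a ∷_) p)

-- An extension of f ↾ k of length at most k is comparable with f: either f is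
-- shorter than k, or the extension is trivial.
extension-comparable : ∀ k f c → length (f ↾ k ++ c) ≤ k → Comparable f (f ↾ k ++ c)
extension-comparable k       []      c _         = inj₁ (take k [] ++ c , refl)
extension-comparable zero    (a ∷ f) []  _       = inj₂ (a ∷ f , refl)
extension-comparable (suc k) (a ∷ f) c   (s≤s ℓ) =
  comparable-∷ a f (f ↾ k ++ c) (extension-comparable k f c ℓ)

comparable-restrict : ∀ k f e → length e ≤ k → Comparable (f ↾ k) e → Comparable f e
comparable-restrict k f .(f ↾ k ++ c) ℓ (inj₁ (c , refl)) = extension-comparable k f c ℓ
comparable-restrict k f e ℓ (inj₂ (c , p)) = inj₂ (c ++ drop k f , e++c++rest≡f)
  where
  e++c++rest≡f : e ++ c ++ drop k f ≡ f
  e++c++rest≡f = trans (sym (++-assoc e c (drop k f)))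
                       (trans (cong (_++ drop k f) p) (take++drop≡id k f))

-- One level l of a squeeze: height j(l), width m(l) and nodes η(l,·) of length j(l).
record Block : Set where
  constructor block
  field
    height      : ℕ
    width       : ℕ
    node        : Fin (suc width) → Seq
    node-length : ∀ t → length (node t) ≡ height
open Block

Touches : Seq → List Block → Set
Touches ν = Any (λ B → Σ (Fin (suc (width B))) λ t → Comparable ν (node B t))

Covers : (Seq → Set) → List Block → Set
Covers T Bs = ∀ ν → T ν → Touches ν Bs

-- The x-bound-system condition, read block by block starting above n.
Chained : (ℕ → ℕ) → ℕ → List Block → Set
Chained x n []       = ⊤
Chained x n (B ∷ Bs) = x (n + width B + 1) < height B × Chained x (height B) Bs

lastHeight : ℕ → List Block → ℕ
lastHeight n []       = n
lastHeight n (B ∷ Bs) = lastHeight (height B) Bs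

chained-++ : ∀ x n Bs Cs → Chained x n Bs → Chained x (lastHeight n Bs) Cs → Chained x n (Bs ++ Cs)
chained-++ x n []       Cs _          chainCs = chainCs
chained-++ x n (B ∷ Bs) Cs (b , chain) chainCs = b , chained-++ x (height B) Bs Cs chain chainCs

ceiling : List Block → ℕ
ceiling Bs = max 0 (map height Bs)

heights≤ceiling : ∀ Bs → All (λ B → height B ≤ ceiling Bs) Bs
heights≤ceiling Bs = All.map⁻ (xs≤max 0 (map height Bs))

touches-restrict : ∀ K ν Bs → All (λ B → height B ≤ K) Bs → Touches (ν ↾ K) Bs → Touches ν Bs
touches-restrict K ν (B ∷ Bs) (h≤K ∷ _) (here (t , c)) =
  here (t , comparable-restrict K ν (node B t) (≤-trans (≤-reflexive (node-length B t)) h≤K) c)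
touches-restrict K ν (B ∷ Bs) (_ ∷ hs≤K) (there touch) = there (touches-restrict K ν Bs hs≤K touch)

SqueezedAbove : (ℕ → ℕ) → (Seq → Set) → ℕ → Set
SqueezedAbove x T n =
  Σ ℕ λ k → Σ (Fin (suc k) → ℕ) λ j → Σ (Fin (suc k) → ℕ) λ m →
    BoundSystem x n k j m ×
    Σ ((l : Fin (suc k)) → Fin (suc (m l)) → Seq) λ η → IsSqueezedBy T k j m η

-- The same data, as a nonempty chained list of blocks covering T.
BlockSqueeze : (ℕ → ℕ) → (Seq → Set) → ℕ → Set
BlockSqueeze x T n = Σ Block λ B → Σ (List Block) λ Bs → Chained x n (B ∷ Bs) × Covers T (B ∷ Bs)

blockAt : ∀ {k} (j m : Fin (suc k) → ℕ) (η : (l : Fin (suc k)) → Fin (suc (m l)) → Seq) →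
  (∀ l t → length (η l t) ≡ j l) → Fin (suc k) → Block
blockAt j m η lengths l = block (j l) (m l) (η l) (lengths l)

blocksOf : (k : ℕ) (j m : Fin (suc k) → ℕ) (η : (l : Fin (suc k)) → Fin (suc (m l)) → Seq) →
  (∀ l t → length (η l t) ≡ j l) → List Block
blocksOf k j m η lengths = tabulate (blockAt j m η lengths)

blocksOf-chained : ∀ x n k j m η lengths → BoundSystem x n k j m → Chained x n (blocksOf k j m η lengths)
blocksOf-chained x n zero    j m η lengths (b₀ , _)    = b₀ , tt
blocksOf-chained x n (suc k) j m η lengths (b₀ , bsuc) =
  b₀ , blocksOf-chained x (j fzero) k (j ∘ fsuc) (m ∘ fsuc) (η ∘ fsuc) (lengths ∘ fsuc)
                          (bsuc fzero , bsuc ∘ fsuc)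

blocks-of-squeeze : ∀ x T n → SqueezedAbove x T n → BlockSqueeze x T n
blocks-of-squeeze x T n (k , j , m , bound , η , lengths , cover) =
  _ , _ , blocksOf-chained x n k j m η lengths bound , covers
  where
  covers : Covers T (blocksOf k j m η lengths)
  covers ν Tν = let l , t , c = cover ν Tν in Any.tabulate⁺ {f = blockAt j m η lengths} l (t , c)

chained-bound : ∀ x n B Bs → Chained x n (B ∷ Bs) →
  BoundSystem x n (length Bs) (λ l → height (lookup (B ∷ Bs) l)) (λ l → width (lookup (B ∷ Bs) l))
chained-bound x n B []       (b , _)     = b , λ ()
chained-bound x n B (C ∷ Bs) (b , chain) =
  let b₀ , bsuc = chained-bound x (height B) C Bs chain
  in  b , λ { fzero → b₀ ; (fsuc l) → bsuc l }

squeeze-of-blocks : ∀ x T n → BlockSqueeze x T n → SqueezedAbove x T n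
squeeze-of-blocks x T n (B , Bs , chain , cover) =
  length Bs , (λ l → height (lookup (B ∷ Bs) l)) , (λ l → width (lookup (B ∷ Bs) l)) ,
  chained-bound x n B Bs chain ,
  (λ l → node (lookup (B ∷ Bs) l)) , (λ l → node-length (lookup (B ∷ Bs) l)) ,
  λ ν Tν → let touch = cover ν Tν in Any.index touch , Any.lookup-index touch

blocks : ∀ {x T n} → BlockSqueeze x T n → List Block
blocks (B , Bs , _) = B ∷ Bs

module FiniteUnions (x : ℕ → ℕ) (T : ℕ → Seq → Set) (squeezed : ∀ a → XSqueezed x (T a)) where

  squeezeFor : ∀ a n → BlockSqueeze x (T a) n
  squeezeFor a n = blocks-of-squeeze x (T a) n (squeezed a n)

  unionBlocks : ℕ → List ℕ → List Block
  unionBlocks n []       = []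
  unionBlocks n (a ∷ as) = blocks (squeezeFor a n) ++ unionBlocks (lastHeight n (blocks (squeezeFor a n))) as

  union-chained : ∀ n as → Chained x n (unionBlocks n as)
  union-chained n []       = tt
  union-chained n (a ∷ as) =
    let _ , _ , chain , _ = squeezeFor a n
    in  chained-++ x n (blocks (squeezeFor a n)) _ chain (union-chained _ as)

  union-covers : ∀ n as a → a ∈ as → Covers (T a) (unionBlocks n as)
  union-covers n (a ∷ as) .a (here refl) ν Tν =
    let _ , _ , _ , cover = squeezeFor a n in Any.++⁺ˡ (cover ν Tν)
  union-covers n (b ∷ as) a (there a∈as) ν Tν =
    Any.++⁺ʳ (blocks (squeezeFor b n)) (union-covers _ as a a∈as ν Tν)

steps⇒strictly-increasing : ∀ f → (∀ n → f n < f (suc n)) → StrictlyIncreasing f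
steps⇒strictly-increasing f step m (suc n) m<1+n with m<1+n⇒m<n∨m≡n m<1+n
... | inj₁ m<n  = <-trans (steps⇒strictly-increasing f step m n m<n) (step n)
... | inj₂ refl = step n

module Diagonal (x : ℕ → ℕ) (T : ℕ → Seq → Set)
                (trees : ∀ a → IsTree (T a)) (squeezed : ∀ a → XSqueezed x (T a)) where
  open FiniteUnions x T squeezed

  -- γ t, and the lists earlier t = γ t, …, γ 0 and before t = γ (t-1), …, γ 0.
  γ : ℕ → ℕ
  earlier before : ℕ → List ℕ
  γ zero    = 0
  γ (suc t) = suc (suc t + γ t + ceiling (unionBlocks t (earlier t)))
  earlier t = γ t ∷ before t
  before zero    = []
  before (suc t) = earlier t

  diagonalBlocks : ℕ → List Block
  diagonalBlocks t = unionBlocks t (earlier t)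

  -- The three inequalities built into the definition of γ (t+1).
  γ-step : ∀ t → γ t < γ (suc t)
  γ-step t = s≤s (≤-trans (m≤n+m (γ t) (suc t)) (m≤m+n _ _))

  γ-large : ∀ t → 0 < t → t < γ t
  γ-large (suc t) _ = s≤s (≤-trans (m≤m+n (suc t) (γ t)) (m≤m+n _ _))

  ceiling≤γ : ∀ t → ceiling (diagonalBlocks t) ≤ γ (suc t)
  ceiling≤γ t = m≤n⇒m≤1+n (m≤n+m _ _)

  γ∈earlier : ∀ s t → s < suc t → γ s ∈ earlier t
  γ∈earlier s zero    (s≤s z≤n) = here refl
  γ∈earlier s (suc t) s<2+t with m<1+n⇒m<n∨m≡n s<2+t
  ... | inj₁ s<1+t = there (γ∈earlier s t s<1+t)
  ... | inj₂ refl  = here refl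

  TStar : Seq → Set
  TStar f = ∀ t → 0 < t → Σ ℕ λ s → s < t × T (γ s) (f ↾ γ t)

  TStar-tree : IsTree TStar
  TStar-tree f .(f ++ c) (c , refl) fc∈T* t 0<t =
    let s , s<t , restriction∈T = fc∈T* t 0<t
    in  s , s<t , trees (γ s) _ _ (restrict-⊑ (γ t) f c) restriction∈T

  -- ν ↾ γ (t+1) lies in some T (γ s) with s ≤ t, hence touches the diagonal
  -- blocks, all of whose nodes are shorter than γ (t+1).
  TStar-covered : ∀ t → Covers TStar (diagonalBlocks t)
  TStar-covered t ν ν∈T* =
    let s , s<1+t , restriction∈T = ν∈T* (suc t) (s≤s z≤n)
        heights≤γ = All.map (λ h≤c → ≤-trans h≤c (ceiling≤γ t)) (heights≤ceiling (diagonalBlocks t))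
    in  touches-restrict (γ (suc t)) ν (diagonalBlocks t) heights≤γ
          (union-covers t (earlier t) (γ s) (γ∈earlier s t s<1+t) _ restriction∈T)

  TStar-squeezed : XSqueezed x TStar
  TStar-squeezed n = squeeze-of-blocks x TStar n (_ , _ , union-chained n (earlier n) , TStar-covered n)

lemma7p13 : (x : ℕ → ℕ) → (∀ n → 0 < x n) → StrictlyIncreasing x →
    (T : ℕ → Seq → Set) → (∀ n → IsTree (T n)) → (∀ n → XSqueezed x (T n)) →
    Σ (Seq → Set) λ Tstar → Σ (ℕ → ℕ) λ γ →
      IsTree Tstar × XSqueezed x Tstar × StrictlyIncreasing γ × γ 0 ≡ 0 ×
      (∀ t → 0 < t → t < γ t) ×
      (∀ f → Tstar f ⇔ (∀ t → 0 < t → Σ ℕ λ s → s < t × T (γ s) (f ↾ γ t)))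
lemma7p13 x _ _ T trees squeezed =
  TStar , γ , TStar-tree , TStar-squeezed , steps⇒strictly-increasing γ γ-step , refl , γ-large ,
  λ f → mk⇔ id id
  where open Diagonal x T trees squeezed
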